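{- Let $A$ be an infinite, closed, subdegree-finite permutation group on a countably infinite set $X$. If all point stabilizers $A_x$ ($x\in X$) are countable, then they are all finite, and $\operatorname{D}(A,X)=2$.
   Context: $\operatorname{Sym}(X)$ carries the permutation topology (generated by cosets of pointwise stabilizers of finite subsets); closed means closed in it. Subdegree-finite means every orbit of every point stabilizer $A_x$ on $X$ is finite. $\operatorname{D}(A,X)$ is the least cardinal $d$ such that some $d$-coloring of $X$ is preserved only by the identity of $A$. -}

module Defs where

open import Data.Nat using (ℕ; _<_)
open import Data.Fin using (Fin)
open import Data.List using (List)
open import Data.List.Membership.Propositional using (_∈_)
open import Data.Product using (Σ; ∃; ∃-syntax; _×_)
open import Relation.Nullary using (¬_)
open import Relation.Binary.PropositionalEquality using (_≡_)
open import Function.Bundles using (_↔_; Inverse)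
open import Function.Construct.Identity using (↔-id)
open import Function.Construct.Composition using (_↔-∘_)
open import Function.Construct.Symmetry using (↔-sym)

-- X is a countably infinite set; w.l.o.g. X = ℕ.
-- Sym(X): bijections ℕ ↔ ℕ.
Perm : Set
Perm = ℕ ↔ ℕ

app : Perm → ℕ → ℕ
app g = Inverse.to g

_≈ₚ_ : Perm → Perm → Set
g ≈ₚ h = ∀ x → app g x ≡ app h x

-- A subset of Sym(X) is a predicate on Perm (respecting ≈ₚ).
PermSet : Set₁
PermSet = Perm → Set

record IsPermGroup (A : PermSet) : Set where
  field
    respects : ∀ g h → g ≈ₚ h → A g → A h
    id∈      : A (↔-id ℕ)
    comp∈    : ∀ g h → A g → A h → A (g ↔-∘ h)
    inv∈     : ∀ g → A g → A (↔-sym g)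

Stab : PermSet → ℕ → PermSet
Stab A x g = A g × (app g x ≡ x)

FiniteP : PermSet → Set
FiniteP S = Σ (List Perm) λ l → ∀ g → S g → ∃[ h ] (h ∈ l × g ≈ₚ h)

InfiniteP : PermSet → Set
InfiniteP S = ¬ FiniteP S

CountableP : PermSet → Set
CountableP S = Σ (ℕ → Perm) λ f →
  (∀ n → S (f n)) × (∀ g → S g → ∃[ n ] (g ≈ₚ f n))

-- closed in the permutation topology: g lies in A whenever every basic
-- neighbourhood {h | h agrees with g on F} (F finite) meets A.
Closed : PermSet → Set
Closed A = ∀ g →
  (∀ (F : List ℕ) → ∃[ h ] (A h × (∀ x → x ∈ F → app h x ≡ app g x))) → A g

SubdegreeFinite : PermSet → Set
SubdegreeFinite A = ∀ x y →
  Σ (List ℕ) λ l → ∀ g → Stab A x g → app g y ∈ l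

Distinguishing : PermSet → (d : ℕ) → (ℕ → Fin d) → Set
Distinguishing A d c =
  ∀ g → A g → (∀ x → c (app g x) ≡ c x) → ∀ x → app g x ≡ x

DistNumberIs : PermSet → ℕ → Set
DistNumberIs A d =
  (∃[ c ] Distinguishing A d c) ×
  (∀ d′ → d′ < d → ¬ (∃[ c ] Distinguishing A d′ c))

module Submission where

-- The argument is classical (excluded middle is a hypothesis) and has three parts.
-- (1) Perfect closed sets are uncountable: if every basic neighbourhood of a
--     closed C ⊆ Sym(ℕ) is infinite, a diagonal sequence of ever finer
--     approximations converges, by closedness, to an element of C that is
--     missed by any given enumeration of C.  If A_x were infinite, then by
--     subdegree-finiteness (the stabiliser of one more point has finite index)
--     every neighbourhood in the closed set A_x would be infinite.
-- (2) Once all A_x are finite, the infinite group A can push any [0,S) beyond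
--     any bound B.  Conjugating a nontrivial element of finite support by such
--     elements yields infinitely many distinct elements of A_0; hence every
--     nontrivial element of A is wild: it moves points beyond every bound.
-- (3) A is covered by the finite fibres {g ∈ A : g 0 ≡ n}.  Recolouring ever
--     larger points breaks the wild permutations of the n-th fibre at stage n;
--     the limit colouring is a distinguishing 2-colouring.  One colour cannot
--     suffice since A is nontrivial, so D(A,ℕ) = 2.
-- Limits of coherent sequences, used for both permutations and colourings, and
-- the finiteness bookkeeping are developed first.

open import Defs
open import Level using (0ℓ)
open import Axiom.ExcludedMiddle using (ExcludedMiddle)
open import Axiom.DoubleNegationElimination using (em⇒dne)
open import Data.Nat using (ℕ; zero; suc; _≤_; _<_; _≤′_; ≤′-refl; ≤′-step; _⊔_; z≤n; s≤s; _≟_; _≤?_)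
open import Data.Nat.Properties
open import Data.Fin using (Fin; toℕ) renaming (zero to fzero; suc to fsuc)
open import Data.Fin.Properties using (pigeonhole)
open import Data.List using (List; []; _∷_; _++_; map; downFrom; lookup; length)
open import Data.List.Extrema.Nat using (max; v≤max⁺)
open import Data.List.Membership.Propositional using (_∈_)
open import Data.List.Membership.Propositional.Properties using (∈-map⁺; ∈-downFrom⁺; ∈-++⁺ˡ; ∈-++⁺ʳ)
open import Data.List.Relation.Unary.Any as Any using (here; there)
open import Data.List.Relation.Unary.Any.Properties using (lookup-index)
open import Data.Product using (∃-syntax; _×_; _,_; proj₁; proj₂)
open import Data.Sum using (_⊎_; inj₁; inj₂)
open import Data.Empty using (⊥; ⊥-elim)
open import Relation.Nullary using (¬_; yes; no)
open import Relation.Binary.PropositionalEquality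
open import Function.Bundles using (Inverse; mk↔ₛ′)
open import Function.Construct.Identity using (↔-id)
open import Function.Construct.Composition using (_↔-∘_)
open import Function.Construct.Symmetry using (↔-sym)

-- A strict upper bound for a finite list of naturals.  It is kept opaque so
-- that bounds of concrete lists are never unfolded during type checking.

opaque
  sup : List ℕ → ℕ
  sup xs = suc (max 0 xs)

  <sup : ∀ {x} xs → x ∈ xs → x < sup xs
  <sup xs x∈xs = s≤s (v≤max⁺ 0 xs (inj₂ (Any.map ≤-reflexive x∈xs)))

monotone : (N : ℕ → ℕ) → (∀ n → N n ≤ N (suc n)) → ∀ {n m} → n ≤ m → N n ≤ N m
monotone N step n≤m = go (≤⇒≤′ n≤m)
  where
  go : ∀ {n m} → n ≤′ m → N n ≤ N m
  go ≤′-refl = ≤-refl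
  go (≤′-step n≤′m) = ≤-trans (go n≤′m) (step _)

from : Perm → ℕ → ℕ
from = Inverse.from

to-from : ∀ g y → app g (from g y) ≡ y
to-from g y = Inverse.inverseˡ g refl

from-to : ∀ g x → from g (app g x) ≡ x
from-to g x = Inverse.inverseʳ g refl

app-injective : ∀ g {a b} → app g a ≡ app g b → a ≡ b
app-injective g {a} {b} e = trans (sym (from-to g a)) (trans (cong (from g) e) (from-to g b))

∘-fixes : ∀ g h {k} → app g k ≡ k → app h k ≡ k → app (g ↔-∘ h) k ≡ k
∘-fixes g h gk hk = trans (cong (app g) hk) gk

sym-fixes : ∀ g {k} → app g k ≡ k → app (↔-sym g) k ≡ k
sym-fixes g {k} gk = trans (cong (from g) (sym gk)) (from-to g k)

PStab : PermSet → (ℕ → Set) → PermSet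
PStab A P h = A h × (∀ k → P k → app h k ≡ k)

stab-group : ∀ {A} → IsPermGroup A → ∀ x → IsPermGroup (Stab A x)
stab-group grp x = record
  { respects = λ g h g≈h (gA , gx) → respects g h g≈h gA , trans (sym (g≈h x)) gx
  ; id∈ = id∈ , refl
  ; comp∈ = λ g h (gA , gx) (hA , hx) → comp∈ g h gA hA , ∘-fixes g h gx hx
  ; inv∈ = λ g (gA , gx) → inv∈ g gA , sym-fixes g gx }
  where open IsPermGroup grp

pstab-group : ∀ {A} → IsPermGroup A → ∀ P → IsPermGroup (PStab A P)
pstab-group grp P = record
  { respects = λ g h g≈h (gA , gP) → respects g h g≈h gA , λ k pk → trans (sym (g≈h k)) (gP k pk)
  ; id∈ = id∈ , λ _ _ → refl
  ; comp∈ = λ g h (gA , gP) (hA , hP) → comp∈ g h gA hA , λ k pk → ∘-fixes g h (gP k pk) (hP k pk)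
  ; inv∈ = λ g (gA , gP) → inv∈ g gA , λ k pk → sym-fixes g (gP k pk) }
  where open IsPermGroup grp

finite-⊆ : {S T : PermSet} → (∀ g → S g → T g) → FiniteP T → FiniteP S
finite-⊆ S⊆T (l , cover) = l , λ g gS → cover g (S⊆T g gS)

finite-∪ : {S T : PermSet} → FiniteP S → FiniteP T → FiniteP (λ g → S g ⊎ T g)
finite-∪ (l₁ , cover₁) (l₂ , cover₂) = l₁ ++ l₂ , λ
  { g (inj₁ gS) → let (h , h∈ , g≈h) = cover₁ g gS in h , ∈-++⁺ˡ h∈ , g≈h
  ; g (inj₂ gT) → let (h , h∈ , g≈h) = cover₂ g gT in h , ∈-++⁺ʳ l₁ h∈ , g≈h }

finite-translate : {S T : PermSet} (p : Perm) →
  (∀ h → T h → S (p ↔-∘ h)) → FiniteP S → FiniteP T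
finite-translate p into (l , cover) = map (↔-sym p ↔-∘_) l , λ h hT →
  let (e , e∈l , ph≈e) = cover (p ↔-∘ h) (into h hT)
  in ↔-sym p ↔-∘ e , ∈-map⁺ _ e∈l ,
     λ y → trans (sym (from-to p (app h y))) (cong (from p) (ph≈e y))

distinct-sequence-infinite : {S : PermSet} (F : ℕ → Perm) →
  (∀ {i j} → i < j → ¬ F i ≈ₚ F j) → (∀ i → S (F i)) → ¬ FiniteP S
distinct-sequence-infinite F distinct inS (l , cover) =
  let (i , j , i<j , same) = pigeonhole (n<1+n (length l)) position
  in distinct i<j λ y → trans (F≈lookup i y) (trans (cong (λ c → app (lookup l c) y) same)
                                                   (sym (F≈lookup j y)))
  where
  position : Fin (suc (length l)) → Fin (length l)
  position i = Any.index (proj₁ (proj₂ (cover (F (toℕ i)) (inS _))))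

  F≈lookup : ∀ i → F (toℕ i) ≈ₚ lookup l (position i)
  F≈lookup i y =
    let (h , h∈l , Fi≈h) = cover (F (toℕ i)) (inS _)
    in trans (Fi≈h y) (cong (λ h → app h y) (lookup-index h∈l))

-- Coherent sequences: s (suc n) agrees with s n below the nondecreasing
-- bounds N n.  They stabilise pointwise, and if N n > n the diagonal
-- lim k = s k k agrees with every s n below N n.
module Coherent {B : Set} (s : ℕ → ℕ → B) (N : ℕ → ℕ)
  (grows : ∀ n → N n ≤ N (suc n))
  (agrees : ∀ n k → k < N n → s (suc n) k ≡ s n k) where

  stable : ∀ {n m} → n ≤ m → ∀ k → k < N n → s m k ≡ s n k
  stable n≤m = go (≤⇒≤′ n≤m)
    where
    go : ∀ {n m} → n ≤′ m → ∀ k → k < N n → s m k ≡ s n k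
    go ≤′-refl k k<N = refl
    go (≤′-step n≤′m) k k<N =
      trans (agrees _ k (<-≤-trans k<N (monotone N grows (≤′⇒≤ n≤′m)))) (go n≤′m k k<N)

  lim : ℕ → B
  lim k = s k k

  lim-agrees : (∀ n → n < N n) → ∀ n k → k < N n → lim k ≡ s n k
  lim-agrees big n k k<N =
    trans (sym (stable (m≤n⊔m n k) k (big k))) (stable (m≤m⊔n n k) k k<N)

-- A coherent sequence of permutations whose inverses are also controlled
-- (the preimage of n is settled by stage n+1) converges to a permutation L,
-- and L lies in every closed set containing the sequence.
module PermutationLimit (p : ℕ → Perm) (N : ℕ → ℕ)
  (grows : ∀ n → N n ≤ N (suc n))
  (agrees : ∀ n k → k < N n → app (p (suc n)) k ≡ app (p n) k)
  (big : ∀ n → n < N n)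
  (preimage : ∀ n → from (p (suc n)) n < N (suc n)) where

  open Coherent (λ n → app (p n)) N grows agrees

  from-stable : ∀ k m → suc k ≤ m → from (p m) k ≡ from (p (suc k)) k
  from-stable k m k<m =
    let j = from (p (suc k)) k
        pm-j : app (p m) j ≡ k
        pm-j = trans (stable k<m j (preimage k)) (to-from (p (suc k)) k)
    in trans (cong (from (p m)) (sym pm-j)) (from-to (p m) j)

  lim⁻¹ : ℕ → ℕ
  lim⁻¹ k = from (p (suc k)) k

  -- Both round trips are computed in a single late enough stage M.
  lim∘lim⁻¹ : ∀ k → lim (lim⁻¹ k) ≡ k
  lim∘lim⁻¹ k =
    let i = lim⁻¹ k
        M = suc (i ⊔ k)
    in begin
      lim i                  ≡⟨ lim-agrees big M i (<-trans (s≤s (m≤m⊔n i k)) (big M)) ⟩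
      app (p M) i            ≡⟨ cong (app (p M)) (sym (from-stable k M (s≤s (m≤n⊔m i k)))) ⟩
      app (p M) (from (p M) k) ≡⟨ to-from (p M) k ⟩
      k ∎
    where open ≡-Reasoning

  lim⁻¹∘lim : ∀ k → lim⁻¹ (lim k) ≡ k
  lim⁻¹∘lim k =
    let j = lim k
        M = suc (k ⊔ j)
    in begin
      from (p (suc j)) j         ≡⟨ sym (from-stable j M (s≤s (m≤n⊔m k j))) ⟩
      from (p M) j               ≡⟨ cong (from (p M)) (lim-agrees big M k (<-trans (s≤s (m≤m⊔n k j)) (big M))) ⟩
      from (p M) (app (p M) k)   ≡⟨ from-to (p M) k ⟩
      k ∎
    where open ≡-Reasoning

  L : Perm
  L = mk↔ₛ′ lim lim⁻¹ lim∘lim⁻¹ lim⁻¹∘lim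

  L-agrees : ∀ n k → k < N n → app L k ≡ app (p n) k
  L-agrees = lim-agrees big

  L∈ : (C : PermSet) → Closed C → (∀ n → C (p n)) → C L
  L∈ C closed pC = closed L λ F →
    let n = sup F
    in p n , pC n , λ x x∈F → sym (L-agrees n x (<-trans (<sup F x∈F) (big n)))

-- Point stabilisers of closed sets are closed (test closedness on F and on x).
stab-closed : ∀ {A} → Closed A → ∀ x → Closed (Stab A x)
stab-closed closed x g near =
  closed g (λ F → let (h , (hA , _) , h≈g) = near F in h , hA , h≈g) ,
  (let (h , (_ , hx) , h≈g) = near (x ∷ []) in trans (sym (h≈g x (here refl))) hx)

Nbhd : PermSet → Perm → ℕ → PermSet
Nbhd C p N h = C h × (∀ k → k < N → app h k ≡ app p k)

Wild : Perm → Set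
Wild e = ∀ M → ∃[ y ] (M ≤ y × ¬ app e y ≡ y)

wild-≈ : ∀ {g e} → g ≈ₚ e → Wild g → Wild e
wild-≈ g≈e wild M = let (y , M≤y , gy≢y) = wild M in y , M≤y , λ ey≡y → gy≢y (trans (g≈e y) ey≡y)

module Classical (lem : ExcludedMiddle 0ℓ) where

  dne : {P : Set} → ¬ ¬ P → P
  dne = em⇒dne lem

  ¬∀⇒∃¬ : {B : Set} {P : B → Set} → ¬ (∀ b → P b) → ∃[ b ] ¬ P b
  ¬∀⇒∃¬ ¬∀ = dne λ ¬∃ → ¬∀ λ b → dne λ ¬Pb → ¬∃ (b , ¬Pb)

  -- In a group with finite stabiliser G_k, each fibre {g : g k ≡ v} of the
  -- orbit map is empty or a coset r·G_k, hence finite; so is every finite union.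
  finite-fibre : ∀ {G} → IsPermGroup G → ∀ k → FiniteP (Stab G k) →
    ∀ v → FiniteP (λ g → G g × app g k ≡ v)
  finite-fibre {G} grp k finite v with lem {∃[ r ] (G r × app r k ≡ v)}
  ... | no empty = [] , λ g (gG , gk) → ⊥-elim (empty (g , gG , gk))
  ... | yes (r , rG , rk) = finite-translate (↔-sym r)
    (λ g (gG , gk) → comp∈ _ _ (inv∈ r rG) gG ,
                     trans (cong (from r) (trans gk (sym rk))) (from-to r k))
    finite
    where open IsPermGroup grp

  finite-cosets : ∀ {G} → IsPermGroup G → ∀ k → FiniteP (Stab G k) →
    ∀ vs → FiniteP (λ g → G g × app g k ∈ vs)
  finite-cosets grp k finite [] = [] , λ { g (_ , ()) }
  finite-cosets {G} grp k finite (v ∷ vs) =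
    finite-⊆ split (finite-∪ (finite-fibre grp k finite v) (finite-cosets grp k finite vs))
    where
    split : ∀ g → G g × app g k ∈ v ∷ vs → (G g × app g k ≡ v) ⊎ (G g × app g k ∈ vs)
    split g (gG , here gk) = inj₁ (gG , gk)
    split g (gG , there gk∈vs) = inj₂ (gG , gk∈vs)

  -- Perfect closed sets are uncountable: given an enumeration f of C, build
  -- approximations p n ∈ C, each refining the previous one and differing
  -- from f n below the new bound; their limit lies in C but is no f m.
  module Perfect (C : PermSet) (closed : Closed C)
    (perfect : ∀ p N → C p → ¬ FiniteP (Nbhd C p N)) where

    escape : ∀ p N → C p → ∀ q → ∃[ h ] (Nbhd C p N h × ∃[ y ] ¬ app h y ≡ app q y)
    escape p N pC q with lem {∃[ h ] (Nbhd C p N h × ¬ h ≈ₚ q)}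
    ... | yes (h , hU , h≉q) = h , hU , ¬∀⇒∃¬ h≉q
    ... | no none = ⊥-elim (perfect p N pC
          (q ∷ [] , λ h hU → q , here refl , dne λ h≉q → none (h , hU , h≉q)))

    -- A stage of the diagonal construction: an element of C, final below bound.
    record Approx : Set where
      field
        perm : Perm
        bound : ℕ
        perm∈ : C perm
    open Approx

    record Refinement (f : ℕ → Perm) (n : ℕ) (s : Approx) : Set where
      field
        next : Approx
        agrees : ∀ k → k < bound s → app (perm next) k ≡ app (perm s) k
        grows : bound s < bound next
        big : suc n < bound next
        preimage : from (perm next) n < bound next
        witness : ℕ
        witness< : witness < bound next
        differs : ¬ app (perm next) witness ≡ app (f n) witness

    refine : ∀ f n s → Refinement f n s
    refine f n s =
      let (h , (hC , h-agrees) , y , hy≢fy) = escape (perm s) (bound s) (perm∈ s) (f n)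
          bounds = bound s ∷ suc n ∷ from h n ∷ y ∷ []
      in record
        { next = record { perm = h ; bound = sup bounds ; perm∈ = hC }
        ; agrees = h-agrees
        ; grows = <sup bounds (here refl)
        ; big = <sup bounds (there (here refl))
        ; preimage = <sup bounds (there (there (here refl)))
        ; witness = y
        ; witness< = <sup bounds (there (there (there (here refl))))
        ; differs = hy≢fy }

    uncountable : ¬ CountableP C
    uncountable (f , f∈ , onto) =
      let (m , L≈fm) = onto L (L∈ C closed (λ n → perm∈ (approx n)))
          r = refinement m
      in Refinement.differs r
           (trans (sym (L-agrees (suc m) _ (Refinement.witness< r))) (L≈fm _))
      where
      approx : ℕ → Approx
      approx zero = record { perm = f 0 ; bound = 1 ; perm∈ = f∈ 0 }
      approx (suc n) = Refinement.next (refine f n (approx n))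

      refinement : ∀ n → Refinement f n (approx n)
      refinement n = refine f n (approx n)

      big : ∀ n → n < bound (approx n)
      big zero = s≤s z≤n
      big (suc n) = Refinement.big (refinement n)

      open PermutationLimit (λ n → perm (approx n)) (λ n → bound (approx n))
        (λ n → <⇒≤ (Refinement.grows (refinement n))) (λ n → Refinement.agrees (refinement n))
        big (λ n → Refinement.preimage (refinement n))

  module FiniteStabilisers {A : PermSet} (grp : IsPermGroup A)
    (subdegree-finite : SubdegreeFinite A) where

    Fix : ℕ → ℕ → PermSet
    Fix x N = PStab (Stab A x) (_< N)

    fix-group : ∀ x N → IsPermGroup (Fix x N)
    fix-group x N = pstab-group (stab-group grp x) (_< N)

    -- Fix x (N+1) is the stabiliser of N in Fix x N, whose N-orbit lies in
    -- the finite A_x-orbit of N; so Fix x (N+1) has finite index in Fix x N.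
    fix-shrink : ∀ x N → FiniteP (Fix x (suc N)) → FiniteP (Fix x N)
    fix-shrink x N finite =
      let (orbit , in-orbit) = subdegree-finite x N
      in finite-⊆ (λ h hFix → hFix , in-orbit h (proj₁ hFix))
           (finite-cosets (fix-group x N) N (finite-⊆ extend finite) orbit)
      where
      extend : ∀ h → Stab (Fix x N) N h → Fix x (suc N) h
      extend h ((hx , h-fix) , hN) = hx , λ k k<1+N → case k (m<1+n⇒m<n∨m≡n k<1+N)
        where
        case : ∀ k → k < N ⊎ k ≡ N → app h k ≡ k
        case k (inj₁ k<N) = h-fix k k<N
        case k (inj₂ refl) = hN

    stab-finite : ∀ x N → FiniteP (Fix x N) → FiniteP (Stab A x)
    stab-finite x zero finite = finite-⊆ (λ g gS → gS , λ k ()) finite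
    stab-finite x (suc N) finite = stab-finite x N (fix-shrink x N finite)

    -- An infinite A_x has all neighbourhoods infinite: p⁻¹·Nbhd ⊇ Fix x N.
    nbhd-infinite : ∀ x → ¬ FiniteP (Stab A x) →
      ∀ p N → Stab A x p → ¬ FiniteP (Nbhd (Stab A x) p N)
    nbhd-infinite x infinite p N pS finite =
      infinite (stab-finite x N (finite-translate p
        (λ h (hS , h-fix) → IsPermGroup.comp∈ (stab-group grp x) p h pS hS ,
                            λ k k<N → cong (app p) (h-fix k k<N))
        finite))

    stabilisers-finite : Closed A → (∀ x → CountableP (Stab A x)) → ∀ x → FiniteP (Stab A x)
    stabilisers-finite closed countable x = dne λ infinite →
      Perfect.uncountable (Stab A x) (stab-closed closed x) (nbhd-infinite x infinite) (countable x)

  module Wildness {A : PermSet} (grp : IsPermGroup A) (infinite : InfiniteP A)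
    (finite : ∀ x → FiniteP (Stab A x)) where
    open IsPermGroup grp

    entering-finite : ∀ S B → FiniteP (λ h → A h × ∃[ k ] (k < S × app h k < B))
    entering-finite zero B = [] , λ { h (_ , k , () , _) }
    entering-finite (suc S) B =
      finite-⊆ split (finite-∪ (finite-cosets grp S (finite S) (downFrom B)) (entering-finite S B))
      where
      split : ∀ h → A h × ∃[ k ] (k < suc S × app h k < B) →
              (A h × app h S ∈ downFrom B) ⊎ (A h × ∃[ k ] (k < S × app h k < B))
      split h (hA , k , k<1+S , hk<B) with m<1+n⇒m<n∨m≡n k<1+S
      ... | inj₁ k<S = inj₂ (hA , k , k<S , hk<B)
      ... | inj₂ refl = inj₁ (hA , ∈-downFrom⁺ hk<B)

    spread : ∀ S B → ∃[ h ] (A h × ∀ k → k < S → B ≤ app h k)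
    spread S B = dne λ none → infinite (finite-⊆ (entering none) (entering-finite S B))
      where
      entering : ¬ (∃[ h ] (A h × ∀ k → k < S → B ≤ app h k)) →
                 ∀ h → A h → A h × ∃[ k ] (k < S × app h k < B)
      entering none h hA =
        let (k , ¬k) = ¬∀⇒∃¬ (λ all → none (h , hA , all))
        in hA , k , dne (λ k≮S → ¬k λ k<S → ⊥-elim (k≮S k<S)) , ≰⇒> (λ B≤hk → ¬k λ _ → B≤hk)

    -- A nontrivial g with support in [0,S) does not exist: conjugates
    -- h g h⁻¹ by spreading h fix [0,B), fix 0, and move h y₀; choosing the
    -- bounds B increasingly makes them pairwise distinct inside A_0.
    module FiniteSupport {g : Perm} (gA : A g) {y₀ : ℕ} (moved : ¬ app g y₀ ≡ y₀)
      {S : ℕ} (support : ∀ y → S ≤ y → app g y ≡ y) where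

      y₀<S : y₀ < S
      y₀<S = ≰⇒> λ S≤y₀ → moved (support y₀ S≤y₀)

      conj : Perm → Perm
      conj h = h ↔-∘ (g ↔-∘ ↔-sym h)

      conj-fixes : ∀ {h B} → (∀ k → k < S → B ≤ app h k) → ∀ k → k < B → app (conj h) k ≡ k
      conj-fixes {h} {B} far k k<B with S ≤? from h k
      ... | yes S≤ = trans (cong (app h) (support _ S≤)) (to-from h k)
      ... | no S≰ = ⊥-elim (<⇒≱ k<B (subst (B ≤_) (to-from h k) (far _ (≰⇒> S≰))))

      conj-moves : ∀ h → ¬ app (conj h) (app h y₀) ≡ app h y₀
      conj-moves h e = moved (app-injective h (trans (cong (λ z → app h (app g z)) (sym (from-to h y₀))) e))

      bounds : ℕ → ℕ
      spreader : ℕ → Perm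
      dominated : ℕ → List ℕ

      bounds zero = 1
      bounds (suc n) = sup (dominated n)
      spreader n = proj₁ (spread S (bounds n))
      dominated n = bounds n ∷ map (app (spreader n)) (downFrom S)

      bounds-grow : ∀ n → bounds n ≤ bounds (suc n)
      bounds-grow n = <⇒≤ (<sup (dominated n) (here refl))

      moved-point< : ∀ n → app (spreader n) y₀ < bounds (suc n)
      moved-point< n = <sup (dominated n) (there (∈-map⁺ _ (∈-downFrom⁺ y₀<S)))

      c : ℕ → Perm
      c n = conj (spreader n)

      c-fixes : ∀ n k → k < bounds n → app (c n) k ≡ k
      c-fixes n = conj-fixes {spreader n} (proj₂ (proj₂ (spread S (bounds n))))

      bounds-positive : ∀ n → 0 < bounds n
      bounds-positive zero = s≤s z≤n
      bounds-positive (suc n) = <-≤-trans (bounds-positive n) (bounds-grow n)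

      c∈A₀ : ∀ n → Stab A 0 (c n)
      c∈A₀ n = comp∈ _ _ hA (comp∈ _ _ gA (inv∈ _ hA)) , c-fixes n 0 (bounds-positive n)
        where
        hA : A (spreader n)
        hA = proj₁ (proj₂ (spread S (bounds n)))

      c-distinct : ∀ {i j} → i < j → ¬ c i ≈ₚ c j
      c-distinct {i} {j} i<j ci≈cj =
        conj-moves (spreader i) (trans (ci≈cj _)
          (c-fixes j _ (<-≤-trans (moved-point< i) (monotone bounds bounds-grow i<j))))

      absurd : ⊥
      absurd = distinct-sequence-infinite c c-distinct c∈A₀ (finite 0)

    nontrivial-wild : ∀ g → A g → ¬ (∀ x → app g x ≡ x) → Wild g
    nontrivial-wild g gA nontrivial M = dne λ tame →
      let (y₀ , moved) = ¬∀⇒∃¬ nontrivial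
      in FiniteSupport.absurd gA moved (λ y M≤y → dne λ gy≢y → tame (y , M≤y , gy≢y))

  module Colouring (enum : ℕ → List Perm) where

    other : Fin 2 → Fin 2
    other fzero = fsuc fzero
    other (fsuc _) = fzero

    other-≢ : ∀ a → ¬ other a ≡ a
    other-≢ fzero ()
    other-≢ (fsuc fzero) ()

    recolour : (ℕ → Fin 2) → ℕ → Fin 2 → ℕ → Fin 2
    recolour c y v k with k ≟ y
    ... | yes _ = v
    ... | no _ = c k

    recolour-at : ∀ c y v → recolour c y v y ≡ v
    recolour-at c y v with y ≟ y
    ... | yes _ = refl
    ... | no y≢y = ⊥-elim (y≢y refl)

    recolour-elsewhere : ∀ c y v k → ¬ k ≡ y → recolour c y v k ≡ c k
    recolour-elsewhere c y v k k≢y with k ≟ y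
    ... | yes k≡y = ⊥-elim (k≢y k≡y)
    ... | no _ = refl

    -- A partial colouring: only the colours below bound are final.
    record Stage : Set where
      field
        colour : ℕ → Fin 2
        bound : ℕ
    open Stage

    _⊑_ : Stage → Stage → Set
    s ⊑ t = bound s ≤ bound t × (∀ k → k < bound s → colour t k ≡ colour s k)

    ⊑-refl : ∀ {s} → s ⊑ s
    ⊑-refl = ≤-refl , λ _ _ → refl

    ⊑-trans : ∀ {s t u} → s ⊑ t → t ⊑ u → s ⊑ u
    ⊑-trans (st , st-agree) (tu , tu-agree) =
      ≤-trans st tu , λ k k< → trans (tu-agree k (<-≤-trans k< st)) (st-agree k k<)

    Broken : Perm → Stage → Set
    Broken e s = ∃[ y ] (y < bound s × app e y < bound s × ¬ colour s y ≡ colour s (app e y))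

    broken-⊑ : ∀ {e s t} → s ⊑ t → Broken e s → Broken e t
    broken-⊑ (s≤t , agree) (y , y< , ey< , differ) =
      y , <-≤-trans y< s≤t , <-≤-trans ey< s≤t ,
      λ same → differ (trans (sym (agree y y<)) (trans same (agree _ ey<)))

    -- A wild e moves some y ≥ bound; giving y the colour opposite to e y breaks e.
    break-one : ∀ e s → ∃[ t ] (s ⊑ t × (Wild e → Broken e t))
    break-one e s with lem {Wild e}
    ... | no tame = s , ⊑-refl , λ wild → ⊥-elim (tame wild)
    ... | yes wild =
      let (y , bound≤y , ey≢y) = wild (bound s)
          v = other (colour s (app e y))
          y≢below : ∀ k → k < bound s → ¬ k ≡ y
          y≢below k k< k≡y = <⇒≱ k< (subst (bound s ≤_) (sym k≡y) bound≤y)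
          settled = bound s ∷ y ∷ app e y ∷ []
      in record { colour = recolour (colour s) y v ; bound = sup settled } ,
         (<⇒≤ (<sup settled (here refl)) , λ k k< → recolour-elsewhere _ y v k (y≢below k k<)) ,
         λ _ → y , <sup settled (there (here refl)) , <sup settled (there (there (here refl))) ,
               λ same → other-≢ (colour s (app e y))
                 (trans (sym (recolour-at (colour s) y v))
                        (trans same (recolour-elsewhere _ y v _ ey≢y)))

    break-all : ∀ l s → ∃[ t ] (s ⊑ t × (∀ {e} → e ∈ l → Wild e → Broken e t))
    break-all [] s = s , ⊑-refl , λ ()
    break-all (e ∷ l) s =
      let (t , s⊑t , breaks-e) = break-one e s
          (u , t⊑u , breaks-l) = break-all l t
      in u , ⊑-trans s⊑t t⊑u , λ
        { (here refl) wild → broken-⊑ {e} t⊑u (breaks-e wild)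
        ; (there e∈l) wild → breaks-l e∈l wild }

    advance : ℕ → Stage → Stage
    advance n s = let t = proj₁ (break-all (enum n) s) in record t { bound = bound t ⊔ suc n }

    advance-⊑ : ∀ n s → s ⊑ advance n s
    advance-⊑ n s = ⊑-trans (proj₁ (proj₂ (break-all (enum n) s))) (m≤m⊔n _ _ , λ _ _ → refl)

    advance-breaks : ∀ n s {e} → e ∈ enum n → Wild e → Broken e (advance n s)
    advance-breaks n s {e} e∈ wild =
      broken-⊑ {e} {proj₁ (break-all (enum n) s)} (m≤m⊔n _ _ , λ _ _ → refl)
        (proj₂ (proj₂ (break-all (enum n) s)) e∈ wild)

    stages : ℕ → Stage
    stages zero = advance 0 record { colour = λ _ → fzero ; bound = 0 }
    stages (suc n) = advance (suc n) (stages n)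

    open Coherent (λ n → colour (stages n)) (λ n → bound (stages n))
      (λ n → proj₁ (advance-⊑ (suc n) (stages n))) (λ n → proj₂ (advance-⊑ (suc n) (stages n)))

    colouring : ℕ → Fin 2
    colouring = lim

    stages-big : ∀ n → n < bound (stages n)
    stages-big zero = m≤n⊔m _ 1
    stages-big (suc n) = m≤n⊔m _ (suc (suc n))

    stages-break : ∀ n {e} → e ∈ enum n → Wild e → Broken e (stages n)
    stages-break zero = advance-breaks 0 _
    stages-break (suc n) = advance-breaks (suc n) (stages n)

    -- The colours witnessing Broken at stage n are final, so they persist in the limit.
    breaks : ∀ n {e} → e ∈ enum n → Wild e → ∃[ y ] ¬ colouring (app e y) ≡ colouring y
    breaks n {e} e∈ wild =
      let (y , y< , ey< , differ) = stages-break n e∈ wild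
      in y , λ same → differ (begin
           colour (stages n) y         ≡⟨ sym (lim-agrees stages-big n y y<) ⟩
           colouring y                 ≡⟨ sym same ⟩
           colouring (app e y)         ≡⟨ lim-agrees stages-big n _ ey< ⟩
           colour (stages n) (app e y) ∎)
      where open ≡-Reasoning

  distinguishing-2-colouring : ∀ {A} (enum : ℕ → List Perm) →
    (∀ g → A g → ∃[ n ] ∃[ e ] (e ∈ enum n × g ≈ₚ e)) →
    (∀ g → A g → ¬ (∀ x → app g x ≡ x) → Wild g) →
    ∃[ c ] Distinguishing A 2 c
  distinguishing-2-colouring enum cover wild =
    colouring , λ g gA preserves → dne λ nontrivial →
      let (n , e , e∈ , g≈e) = cover g gA
          (y , differ) = breaks n {e} e∈ (wild-≈ {g} {e} g≈e (wild g gA nontrivial))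
      in differ (trans (cong colouring (sym (g≈e y))) (preserves y))
    where open Colouring enum

-- An infinite group admits no distinguishing colouring with fewer than 2 colours:
-- there is no 0-colouring, and every element preserves a 1-colouring.
at-least-2-colours : ∀ {A} → InfiniteP A → ∀ d → d < 2 → ¬ (∃[ c ] Distinguishing A d c)
at-least-2-colours infinite zero _ (c , _) with c 0
... | ()
at-least-2-colours infinite (suc zero) _ (c , distinguishing) =
  infinite (↔-id ℕ ∷ [] , λ g gA → ↔-id ℕ , here refl , distinguishing g gA (λ x → one-colour _ _))
  where
  one-colour : (a b : Fin 1) → a ≡ b
  one-colour fzero fzero = refl
at-least-2-colours infinite (suc (suc _)) (s≤s (s≤s ()))

corollary3p10 : ExcludedMiddle 0ℓ →
    (A : PermSet) → IsPermGroup A → InfiniteP A → Closed A →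
    SubdegreeFinite A → (∀ x → CountableP (Stab A x)) →
    (∀ x → FiniteP (Stab A x)) × DistNumberIs A 2
corollary3p10 lem A grp infinite closed subdegree-finite countable =
  finite , distinguishing-2-colouring enum cover (Wildness.nontrivial-wild grp infinite finite) ,
  at-least-2-colours infinite
  where
  open Classical lem
  finite : ∀ x → FiniteP (Stab A x)
  finite = FiniteStabilisers.stabilisers-finite grp subdegree-finite closed countable

  fibres : (n : ℕ) → FiniteP (λ g → A g × app g 0 ≡ n)
  fibres n = finite-fibre grp 0 (finite 0) n

  enum : ℕ → List Perm
  enum n = proj₁ (fibres n)

  cover : ∀ g → A g → ∃[ n ] ∃[ e ] (e ∈ enum n × g ≈ₚ e)
  cover g gA = app g 0 , proj₂ (fibres (app g 0)) g (gA , refl)
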